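{- Let $n > 3$ be an integer. Then stit logic does not have the Restricted $n$-Craig Interpolation Property $(RCIP)_n$; that is, there exist a set of propositional variables $V$ and formulas $A, B \in \mathcal{L}^{\{1,\ldots,n\}}_V$ with $\vdash A \to B$ and $Ag(A) \cap Ag(B) = \emptyset$ such that there is no $C \in \mathcal{L}^{Ag(A)\cup Ag(B)}_{|A|\cap|B|}$ with both $\vdash A \to C$ and $\vdash C \to B$.
   Context: For a finite set $Ag$ of agent indices and a set $V$ of propositional variables, $\mathcal{L}^{Ag}_V$ is the set of stit formulas given by $A ::= p \mid A \to A \mid \bot \mid \Box A \mid [j]A$ with $p \in V$, $j \in Ag$ (other Boolean connectives defined as usual; $\Diamond A := \neg\Box\neg A$). $\vdash A$ means that $A$ is derivable in the axiom system $\mathbb{S}$ whose axioms are: all classical propositional tautologies; the S5 axioms for $\Box$ and for each $[j]$; $\Box A \to [j]A$ for each $j$; and $(\Diamond[j_1]A_1 \wedge\dots\wedge \Diamond[j_k]A_k) \to \Diamond([j_1]A_1\wedge\dots\wedge[j_k]A_k)$ for pairwise distinct $j_1,\dots,j_k$; and whose rules are modus ponens and necessitation for $\Box$. (This system is sound and strongly complete for the standard branching-time stit semantics with Chellas stit operators.) For a formula $A$, $|A|$ is the set of propositional variables occurring in $A$ and $Ag(A)$ the set of agent indices occurring in $A$. -}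

module Defs where

open import Data.Nat using (ℕ)
open import Data.Fin using (Fin)
open import Data.Bool using (Bool; true; false; if_then_else_)
open import Data.List using (List; []; _∷_)
open import Data.List.Relation.Unary.AllPairs using (AllPairs)
open import Data.Product using (_×_; _,_; proj₁; proj₂; Σ)
open import Data.Sum using (_⊎_)
open import Data.Empty using (⊥)
open import Relation.Binary.PropositionalEquality using (_≡_; _≢_)
open import Relation.Nullary using (¬_)

infixr 5 _⇒_

data Form (V : Set) (Ag : Set) : Set where
  var  : V → Form V Ag
  _⇒_  : Form V Ag → Form V Ag → Form V Ag
  bot  : Form V Ag
  □    : Form V Ag → Form V Ag
  stit : Ag → Form V Ag → Form V Ag

module _ {V Ag : Set} where
  ¬F : Form V Ag → Form V Ag
  ¬F A = A ⇒ bot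

  ⊤F : Form V Ag
  ⊤F = ¬F bot

  _∧F_ : Form V Ag → Form V Ag → Form V Ag
  A ∧F B = ¬F (A ⇒ ¬F B)

  ◇ : Form V Ag → Form V Ag
  ◇ A = ¬F (□ (¬F A))

  conj : Form V Ag → List (Form V Ag) → Form V Ag
  conj A []       = A
  conj A (B ∷ Bs) = A ∧F conj B Bs

  -- Classical tautologies: formulas true under every Boolean valuation of
  -- their maximal non-Boolean subformulas (variables, □-formulas, [j]-formulas).
  eval : (Form V Ag → Bool) → Form V Ag → Bool
  eval v (var p)    = v (var p)
  eval v (A ⇒ B)    = if eval v A then eval v B else true
  eval v bot        = false
  eval v (□ A)      = v (□ A)
  eval v (stit j A) = v (stit j A)

  Tautology : Form V Ag → Set
  Tautology A = (v : Form V Ag → Bool) → eval v A ≡ true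

  stitPair : Ag × Form V Ag → Form V Ag
  stitPair (j , A) = stit j A

  mapL : {X Y : Set} → (X → Y) → List X → List Y
  mapL f []       = []
  mapL f (x ∷ xs) = f x ∷ mapL f xs

  data ⊢_ : Form V Ag → Set where
    taut  : ∀ {A} → Tautology A → ⊢ A
    □K    : ∀ A B → ⊢ (□ (A ⇒ B) ⇒ □ A ⇒ □ B)
    □T    : ∀ A → ⊢ (□ A ⇒ A)
    □5    : ∀ A → ⊢ (◇ A ⇒ □ (◇ A))
    stK   : ∀ j A B → ⊢ (stit j (A ⇒ B) ⇒ stit j A ⇒ stit j B)
    stT   : ∀ j A → ⊢ (stit j A ⇒ A)
    st5   : ∀ j A → ⊢ (¬F (stit j (¬F A)) ⇒ stit j (¬F (stit j (¬F A))))
    □st   : ∀ j A → ⊢ (□ A ⇒ stit j A)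
    indep : ∀ (x : Ag × Form V Ag) (xs : List (Ag × Form V Ag)) →
            AllPairs _≢_ (mapL proj₁ (x ∷ xs)) →
            ⊢ (conj (◇ (stitPair x)) (mapL (λ y → ◇ (stitPair y)) xs)
                 ⇒ ◇ (conj (stitPair x) (mapL stitPair xs)))
    mp    : ∀ {A B} → ⊢ (A ⇒ B) → ⊢ A → ⊢ B
    nec   : ∀ {A} → ⊢ A → ⊢ □ A

  data VarIn (p : V) : Form V Ag → Set where
    here  : VarIn p (var p)
    impL  : ∀ {A B} → VarIn p A → VarIn p (A ⇒ B)
    impR  : ∀ {A B} → VarIn p B → VarIn p (A ⇒ B)
    inBox : ∀ {A} → VarIn p A → VarIn p (□ A)
    inSt  : ∀ {j A} → VarIn p A → VarIn p (stit j A)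

  data AgIn (j : Ag) : Form V Ag → Set where
    impL  : ∀ {A B} → AgIn j A → AgIn j (A ⇒ B)
    impR  : ∀ {A B} → AgIn j B → AgIn j (A ⇒ B)
    inBox : ∀ {A} → AgIn j A → AgIn j (□ A)
    stHere : ∀ {A} → AgIn j (stit j A)
    inSt  : ∀ {k A} → AgIn j A → AgIn j (stit k A)

  InLanguage : Form V Ag → Form V Ag → Form V Ag → Set
  InLanguage A B C =
    (∀ p → VarIn p C → VarIn p A × VarIn p B) ×
    (∀ j → AgIn j C → AgIn j A ⊎ AgIn j B)

  AgDisjoint : Form V Ag → Form V Ag → Set
  AgDisjoint A B = ∀ j → AgIn j A → AgIn j B → ⊥

-- The formula A = [a₀]q₁ ∧ [a₁]q₂ ∧ □(q₁ ∧ q₂ → p) entails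
-- B = ¬(◇[a₂]r₁ ∧ ◇[a₃]r₂ ∧ □(r₁ ∧ r₂ → ¬p)): by independence of agents the four
-- choices are jointly possible, and together they would force both p and ¬p.
-- Only p is shared, yet no formula in p alone separates A from B. Take models whose
-- histories are bit profiles, agent j choosing bit j, where p says that bits 0 and 1
-- agree in the first model and that bits 2 and 3 agree in the second. A holds in the
-- first and B fails in the second at the all-true profile; and in both models p is
-- settled neither by any choice nor historically, so a formula in p alone takes the same
-- truth value at any two points where p does. An interpolant would carry A's truth over to B.

module Submission where

open import Defs
open import Data.Nat using (ℕ; zero; suc; _+_; _<_; s≤s)
open import Data.Fin using (Fin; zero; suc)
open import Data.Fin.Properties using () renaming (_≟_ to _≟ᶠ_)
open import Data.Bool using (Bool; true; false; not; if_then_else_)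
open import Data.Bool.Properties using (_≟_; not-injective)
open import Data.Vec using (Vec; []; _∷_; lookup; replicate; _[_]≔_)
open import Data.Vec.Properties using (lookup∘update; lookup∘update′)
open import Data.List using (List; []; _∷_)
open import Data.List.Relation.Unary.All using (All; []; _∷_; mapM)
open import Data.List.Relation.Unary.AllPairs using (AllPairs; []; _∷_)
open import Data.Product using (Σ; _×_; _,_; proj₁; map₂)
open import Data.Unit using (⊤)
open import Data.Empty using (⊥; ⊥-elim)
open import Function using (_∘_; id; case_of_)
open import Function.Bundles using (_⇔_; mk⇔; module Equivalence)
open import Function.Properties.Equivalence using () renaming (trans to ⇔-trans)
open import Function.Related.TypeIsomorphisms using (→-cong-⇔)
open import Level using (0ℓ)
open import Relation.Binary.PropositionalEquality using (_≡_; _≢_; refl; sym; trans; cong; cong₂)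
open import Relation.Nullary using (¬_; Dec; yes; no; does)
open import Relation.Nullary.Decidable using (map′; _×-dec_; _→-dec_; decidable-stable)
open import Relation.Nullary.Negation using (¬¬-Monad; ¬¬-map)

open Equivalence using (to; from)

module _ {V Ag : Set} where

  private variable
    A B C H : Form V Ag
    x : V
    j : Ag

  AllVars : (V → Set) → Form V Ag → Set
  AllVars P (var y)    = P y
  AllVars P (A ⇒ B)    = AllVars P A × AllVars P B
  AllVars P bot        = ⊤
  AllVars P (□ A)      = AllVars P A
  AllVars P (stit _ A) = AllVars P A

  AllVars⇒VarIn : {P : V → Set} → AllVars P C → VarIn x C → P x
  AllVars⇒VarIn {C = var _}    h        here      = h
  AllVars⇒VarIn {C = _ ⇒ _}    (h , _)  (impL i)  = AllVars⇒VarIn h i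
  AllVars⇒VarIn {C = _ ⇒ _}    (_ , h)  (impR i)  = AllVars⇒VarIn h i
  AllVars⇒VarIn {C = □ _}      h        (inBox i) = AllVars⇒VarIn h i
  AllVars⇒VarIn {C = stit _ _} h        (inSt i)  = AllVars⇒VarIn h i

  VarIn⇒AllVars : {P : V → Set} → (∀ y → VarIn y C → P y) → AllVars P C
  VarIn⇒AllVars {C = var y}    h = h y here
  VarIn⇒AllVars {C = A ⇒ B}    h = VarIn⇒AllVars (λ y → h y ∘ impL) , VarIn⇒AllVars (λ y → h y ∘ impR)
  VarIn⇒AllVars {C = bot}      h = _
  VarIn⇒AllVars {C = □ A}      h = VarIn⇒AllVars (λ y → h y ∘ inBox)
  VarIn⇒AllVars {C = stit _ A} h = VarIn⇒AllVars (λ y → h y ∘ inSt)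

  AllAgents : (Ag → Set) → Form V Ag → Set
  AllAgents P (var _)    = ⊤
  AllAgents P (A ⇒ B)    = AllAgents P A × AllAgents P B
  AllAgents P bot        = ⊤
  AllAgents P (□ A)      = AllAgents P A
  AllAgents P (stit k A) = P k × AllAgents P A

  AllAgents⇒AgIn : {P : Ag → Set} → AllAgents P C → AgIn j C → P j
  AllAgents⇒AgIn {C = _ ⇒ _}    (h , _) (impL i)  = AllAgents⇒AgIn h i
  AllAgents⇒AgIn {C = _ ⇒ _}    (_ , h) (impR i)  = AllAgents⇒AgIn h i
  AllAgents⇒AgIn {C = □ _}      h       (inBox i) = AllAgents⇒AgIn h i
  AllAgents⇒AgIn {C = stit _ _} (h , _) stHere    = h
  AllAgents⇒AgIn {C = stit _ _} (_ , h) (inSt i)  = AllAgents⇒AgIn h i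

  ⊢-weaken : ⊢ A → ⊢ (H ⇒ A)
  ⊢-weaken {A = A} {H = H} = mp (taut K)
    where
    K : Tautology (A ⇒ H ⇒ A)
    K v with eval v A | eval v H
    ... | false | _     = refl
    ... | true  | false = refl
    ... | true  | true  = refl

  ⊢-app : ⊢ (H ⇒ A ⇒ B) → ⊢ (H ⇒ A) → ⊢ (H ⇒ B)
  ⊢-app {H = H} {A = A} {B = B} f a = mp (mp (taut S) f) a
    where
    S : Tautology ((H ⇒ A ⇒ B) ⇒ (H ⇒ A) ⇒ H ⇒ B)
    S v with eval v H | eval v A | eval v B
    ... | false | _     | _     = refl
    ... | true  | false | _     = refl
    ... | true  | true  | false = refl
    ... | true  | true  | true  = refl

  infixr 9 _⊢∘_
  _⊢∘_ : ⊢ (B ⇒ C) → ⊢ (A ⇒ B) → ⊢ (A ⇒ C)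
  g ⊢∘ f = ⊢-app (⊢-weaken g) f

  ⊢-pair : ⊢ (H ⇒ A) → ⊢ (H ⇒ B) → ⊢ (H ⇒ A ∧F B)
  ⊢-pair {A = A} {B = B} a b = ⊢-app (⊢-app (⊢-weaken (taut pair)) a) b
    where
    pair : Tautology (A ⇒ B ⇒ A ∧F B)
    pair v with eval v A | eval v B
    ... | false | _     = refl
    ... | true  | false = refl
    ... | true  | true  = refl

  ⊢-fst : ⊢ (A ∧F B ⇒ A)
  ⊢-fst {A = A} {B = B} = taut fst
    where
    fst : Tautology (A ∧F B ⇒ A)
    fst v with eval v A | eval v B
    ... | false | _     = refl
    ... | true  | false = refl
    ... | true  | true  = refl

  ⊢-snd : ⊢ (A ∧F B ⇒ B)
  ⊢-snd {A = A} {B = B} = taut snd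
    where
    snd : Tautology (A ∧F B ⇒ B)
    snd v with eval v A | eval v B
    ... | false | _     = refl
    ... | true  | false = refl
    ... | true  | true  = refl

  ⊢-curry : ⊢ (H ∧F A ⇒ B) → ⊢ (H ⇒ A ⇒ B)
  ⊢-curry {H = H} {A = A} {B = B} = mp (taut curry)
    where
    curry : Tautology ((H ∧F A ⇒ B) ⇒ H ⇒ A ⇒ B)
    curry v with eval v H | eval v A | eval v B
    ... | false | _     | _     = refl
    ... | true  | false | _     = refl
    ... | true  | true  | false = refl
    ... | true  | true  | true  = refl

  ◇-intro : ⊢ (A ⇒ ◇ A)
  ◇-intro {A = A} = ⊢-curry (⊢-app (□T (¬F A) ⊢∘ ⊢-snd) ⊢-fst)

  □-lift₂ : ⊢ (A ⇒ B ⇒ C) → ⊢ (□ A ⇒ □ B ⇒ □ C)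
  □-lift₂ {A = A} {B = B} {C = C} d = □K B C ⊢∘ mp (□K A (B ⇒ C)) (nec d)

Profile : ℕ → Set
Profile n = Vec Bool n

Valuation : Set → ℕ → Set
Valuation V n = V → Profile n → Bool

∀-Bool? : {P : Bool → Set} → (∀ b → Dec (P b)) → Dec (∀ b → P b)
∀-Bool? P? = map′ (λ { (f , t) false → f ; (f , t) true → t }) (λ h → h false , h true)
                  (P? false ×-dec P? true)

∀-Profile? : ∀ {n} {P : Profile n → Set} → (∀ u → Dec (P u)) → Dec (∀ u → P u)
∀-Profile? {zero}  P? = map′ (λ { p [] → p }) (λ h → h []) (P? [])
∀-Profile? {suc n} P? = map′ (λ { h (b ∷ u) → h b u }) (λ h b u → h (b ∷ u))
                             (∀-Bool? λ b → ∀-Profile? λ u → P? (b ∷ u))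

does-⇔ : ∀ {P : Set} (P? : Dec P) → does P? ≡ true ⇔ P
does-⇔ (yes a) = mk⇔ (λ _ → a) (λ _ → refl)
does-⇔ (no ¬a) = mk⇔ (λ ()) (λ a → ⊥-elim (¬a a))

if-then-true : ∀ {a b} → (if a then b else true) ≡ true ⇔ (a ≡ true → b ≡ true)
if-then-true {false} = mk⇔ (λ _ ()) (λ _ → refl)
if-then-true {true}  = mk⇔ (λ h _ → h) (λ h → h refl)

module _ {V : Set} {n : ℕ} where

  private variable
    A B : Form V (Fin n)
    val : Valuation V n
    w : Profile n

  infix 4 _∣_⊨_ _∣_⊨?_

  _∣_⊨_ : Valuation V n → Profile n → Form V (Fin n) → Set
  val ∣ w ⊨ var x    = val x w ≡ true
  val ∣ w ⊨ (A ⇒ B)  = val ∣ w ⊨ A → val ∣ w ⊨ B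
  val ∣ w ⊨ bot      = ⊥
  val ∣ w ⊨ □ A      = ∀ u → val ∣ u ⊨ A
  val ∣ w ⊨ stit j A = ∀ u → lookup u j ≡ lookup w j → val ∣ u ⊨ A

  _∣_⊨?_ : ∀ val w A → Dec (val ∣ w ⊨ A)
  val ∣ w ⊨? var x    = val x w ≟ true
  val ∣ w ⊨? (A ⇒ B)  = val ∣ w ⊨? A →-dec val ∣ w ⊨? B
  val ∣ w ⊨? bot      = no id
  val ∣ w ⊨? □ A      = ∀-Profile? λ u → val ∣ u ⊨? A
  val ∣ w ⊨? stit j A = ∀-Profile? λ u → lookup u j ≟ lookup w j →-dec val ∣ u ⊨? A

  eval-⊨ : ∀ A → eval (λ B → does (val ∣ w ⊨? B)) A ≡ true ⇔ val ∣ w ⊨ A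
  eval-⊨ {val} {w} (var x)    = does-⇔ (val ∣ w ⊨? var x)
  eval-⊨           (A ⇒ B)    = ⇔-trans if-then-true (→-cong-⇔ (eval-⊨ A) (eval-⊨ B))
  eval-⊨           bot        = mk⇔ (λ ()) (λ ())
  eval-⊨ {val} {w} (□ A)      = does-⇔ (val ∣ w ⊨? □ A)
  eval-⊨ {val} {w} (stit j A) = does-⇔ (val ∣ w ⊨? stit j A)

  ⊨-∧ : val ∣ w ⊨ A ∧F B ⇔ (val ∣ w ⊨ A × val ∣ w ⊨ B)
  ⊨-∧ {val} {w} {A} {B} = mk⇔
    (λ h → decidable-stable (val ∣ w ⊨? A) (λ ¬a → h λ a _ → ¬a a)
         , decidable-stable (val ∣ w ⊨? B) (λ ¬b → h λ _ b → ¬b b))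
    (λ { (a , b) k → k a b })

  ⊨-◇ : val ∣ w ⊨ ◇ A ⇔ (¬ ¬ Σ (Profile n) λ u → val ∣ u ⊨ A)
  ⊨-◇ = mk⇔ (λ h k → h λ u a → k (u , a)) (λ h k → h λ { (u , a) → k u a })

  ⊨-conj-map : ∀ {X : Set} (f : X → Form V (Fin n)) y ys →
               val ∣ w ⊨ conj (f y) (mapL {V} {Fin n} f ys) ⇔ All (λ z → val ∣ w ⊨ f z) (y ∷ ys)
  ⊨-conj-map f y []       = mk⇔ (_∷ []) (λ { (h ∷ []) → h })
  ⊨-conj-map f y (z ∷ zs) = ⇔-trans ⊨-∧
    (mk⇔ (λ { (h , hs) → h ∷ to (⊨-conj-map f z zs) hs })
         (λ { (h ∷ hs) → h , from (⊨-conj-map f z zs) hs }))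

  stit-local : ∀ u w {j} → lookup u j ≡ lookup w j → val ∣ u ⊨ stit j A → val ∣ w ⊨ stit j A
  stit-local _ _ e h v e′ = h v (trans e′ (sym e))

  update-preserves : ∀ {j} (w : Profile n) b (L : List (Fin n × Form V (Fin n))) →
                     All (j ≢_) (mapL {V} {Fin n} proj₁ L) →
                     All (λ y → val ∣ w ⊨ stitPair y) L → All (λ y → val ∣ w [ j ]≔ b ⊨ stitPair y) L
  update-preserves w b []            []            []       = []
  update-preserves {j = j} w b ((k , _) ∷ L) (j≢k ∷ j≢L) (h ∷ hs) =
    stit-local w (w [ j ]≔ b) (sym (lookup∘update′ (j≢k ∘ sym) w b)) h
    ∷ update-preserves w b L j≢L hs

  -- Distinct agents control distinct bits, so their choices can be combined into one profile.
  independence : (L : List (Fin n × Form V (Fin n))) → AllPairs _≢_ (mapL {V} {Fin n} proj₁ L) →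
                 All (λ y → Σ (Profile n) λ u → val ∣ u ⊨ stitPair y) L →
                 Σ (Profile n) λ w → All (λ y → val ∣ w ⊨ stitPair y) L
  independence []            []                   []                = replicate n false , []
  independence ((j , _) ∷ L) (j∉L ∷ distinct) ((u , u⊨) ∷ sats) =
    let (w , w⊨) = independence L distinct sats
        b = lookup u j
    in  w [ j ]≔ b
      , stit-local u (w [ j ]≔ b) (sym (lookup∘update j w b)) u⊨
      ∷ update-preserves w b L j∉L w⊨

  sound : ⊢ A → ∀ val w → val ∣ w ⊨ A
  sound (taut t)      val w = to (eval-⊨ _) (t _)
  sound (□K A B)      val w = λ f a u → f u (a u)
  sound (□T A)        val w = λ h → h w
  sound (□5 A)        val w = λ h u → h
  sound (stK j A B)   val w = λ f a u e → f u e (a u e)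
  sound (stT j A)     val w = λ h → h w refl
  sound (st5 j A)     val w = λ h u e g → h λ v e′ → g v (trans e′ (sym e))
  sound (□st j A)     val w = λ h u _ → h u
  sound (indep y ys distinct) val w = λ hyp → from (⊨-◇ {w = w})
    (¬¬-map (map₂ (from (⊨-conj-map stitPair y ys)) ∘ independence (y ∷ ys) distinct)
            (mapM 0ℓ ¬¬-Monad (λ {z} → to (⊨-◇ {val = val} {w = w} {A = stitPair z}))
                  (to (⊨-conj-map (◇ ∘ stitPair) y ys) hyp)))
  sound (mp f a)      val w = sound f val w (sound a val w)
  sound (nec a)       val w = λ u → sound a val u

module _ {n : ℕ} where

  record NeverSettled (f : Profile n → Bool) : Set where
    field
      somewhere     : ∀ b → Σ (Profile n) λ u → f u ≡ b
      in-every-cell : ∀ j w b → Σ (Profile n) λ u → lookup u j ≡ lookup w j × f u ≡ b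

  agree : Fin n → Fin n → Profile n → Bool
  agree i k u = does (lookup u i ≟ lookup u k)

  private
    partnerʳ : ∀ a b → Σ Bool λ c → does (a ≟ c) ≡ b
    partnerʳ false false = true  , refl
    partnerʳ false true  = false , refl
    partnerʳ true  false = false , refl
    partnerʳ true  true  = true  , refl

    partnerˡ : ∀ a b → Σ Bool λ c → does (c ≟ a) ≡ b
    partnerˡ false false = true  , refl
    partnerˡ false true  = false , refl
    partnerˡ true  false = false , refl
    partnerˡ true  true  = true  , refl

  -- Within a cell of agent i bit k is free, within any other cell bit i is, and either sets agree i k.
  agree-neverSettled : ∀ {i k} → i ≢ k → NeverSettled (agree i k)
  agree-neverSettled {i} {k} i≢k = record
    { somewhere     = λ b → let (u , _ , e) = in-every-cell i (replicate n false) b in u , e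
    ; in-every-cell = in-every-cell
    }
    where
    in-every-cell : ∀ j w b → Σ (Profile n) λ u → lookup u j ≡ lookup w j × agree i k u ≡ b
    in-every-cell j w b with j ≟ᶠ i
    ... | yes refl =
      let (c , e) = partnerʳ (lookup w i) b
      in  w [ k ]≔ c
        , lookup∘update′ i≢k w c
        , trans (cong₂ (λ x y → does (x ≟ y)) (lookup∘update′ i≢k w c) (lookup∘update k w c)) e
    ... | no j≢i =
      let (c , e) = partnerˡ (lookup w k) b
      in  w [ i ]≔ c
        , lookup∘update′ j≢i w c
        , trans (cong₂ (λ x y → does (x ≟ y)) (lookup∘update i w c) (lookup∘update′ (i≢k ∘ sym) w c)) e

module _ {V : Set} {n : ℕ} (x : V) (val₁ val₂ : Valuation V n)
         (unsettled₁ : NeverSettled (val₁ x)) (unsettled₂ : NeverSettled (val₂ x)) where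

  open NeverSettled

  -- As x is settled nowhere, □ and every [j] always range over both truth values of x.
  ⊨-transfer : ∀ C → AllVars (_≡ x) C → ∀ {w v} → val₁ x w ≡ val₂ x v →
               val₁ ∣ w ⊨ C ⇔ val₂ ∣ v ⊨ C
  ⊨-transfer (var _) refl e = mk⇔ (trans (sym e)) (trans e)
  ⊨-transfer (A ⇒ B) (onlyA , onlyB) e = →-cong-⇔ (⊨-transfer A onlyA e) (⊨-transfer B onlyB e)
  ⊨-transfer bot _ e = mk⇔ id id
  ⊨-transfer (□ A) only e = mk⇔
    (λ h v′ → let (u , e′) = somewhere unsettled₁ (val₂ x v′) in to (⊨-transfer A only e′) (h u))
    (λ h u′ → let (v , e′) = somewhere unsettled₂ (val₁ x u′) in from (⊨-transfer A only (sym e′)) (h v))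
  ⊨-transfer (stit j A) only {w} {v} e = mk⇔
    (λ h v′ _ → let (u , same , e′) = in-every-cell unsettled₁ j w (val₂ x v′)
                in  to (⊨-transfer A only e′) (h u same))
    (λ h u′ _ → let (v′ , same , e′) = in-every-cell unsettled₂ j v (val₁ x u′)
                in  from (⊨-transfer A only (sym e′)) (h v′ same))

data Var : Set where
  p q₁ q₂ r₁ r₂ : Var

module Counterexample (m : ℕ) where

  Agent : Set
  Agent = Fin (4 + m)

  a₀ a₁ a₂ a₃ : Agent
  a₀ = zero
  a₁ = suc zero
  a₂ = suc (suc zero)
  a₃ = suc (suc (suc zero))

  S₀ S₁ S₂ S₃ q⇒p r⇒¬p joint opposition antecedent consequent : Form Var Agent
  S₀ = stit a₀ (var q₁)
  S₁ = stit a₁ (var q₂)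
  S₂ = stit a₂ (var r₁)
  S₃ = stit a₃ (var r₂)
  q⇒p = var q₁ ∧F var q₂ ⇒ var p
  r⇒¬p = var r₁ ∧F var r₂ ⇒ ¬F (var p)
  joint = S₀ ∧F (S₁ ∧F (S₂ ∧F S₃))
  opposition = ◇ S₂ ∧F (◇ S₃ ∧F □ r⇒¬p)
  antecedent = S₀ ∧F (S₁ ∧F □ q⇒p)
  consequent = ¬F opposition

  joint-excluded : ⊢ (q⇒p ⇒ r⇒¬p ⇒ ¬F joint)
  joint-excluded = ⊢-curry (⊢-curry (⊢-app (⊢-app (⊢-snd ⊢∘ ⊢-fst) r₁∧r₂) (⊢-app (⊢-fst ⊢∘ ⊢-fst) q₁∧q₂)))
    where
    Γ : Form Var Agent
    Γ = (q⇒p ∧F r⇒¬p) ∧F joint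
    q₁∧q₂ : ⊢ (Γ ⇒ var q₁ ∧F var q₂)
    q₁∧q₂ = ⊢-pair (stT a₀ (var q₁) ⊢∘ ⊢-fst ⊢∘ ⊢-snd) (stT a₁ (var q₂) ⊢∘ ⊢-fst ⊢∘ ⊢-snd ⊢∘ ⊢-snd)
    r₁∧r₂ : ⊢ (Γ ⇒ var r₁ ∧F var r₂)
    r₁∧r₂ = ⊢-pair (stT a₂ (var r₁) ⊢∘ ⊢-fst ⊢∘ ⊢-snd ⊢∘ ⊢-snd ⊢∘ ⊢-snd)
                   (stT a₃ (var r₂) ⊢∘ ⊢-snd ⊢∘ ⊢-snd ⊢∘ ⊢-snd ⊢∘ ⊢-snd)

  antecedent⇒consequent : ⊢ (antecedent ⇒ consequent)
  antecedent⇒consequent = ⊢-curry (⊢-app ◇joint □¬joint)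
    where
    Γ : Form Var Agent
    Γ = antecedent ∧F opposition
    ◇joint : ⊢ (Γ ⇒ ◇ joint)
    ◇joint = indep (a₀ , var q₁) ((a₁ , var q₂) ∷ (a₂ , var r₁) ∷ (a₃ , var r₂) ∷ [])
                   (((λ ()) ∷ (λ ()) ∷ (λ ()) ∷ []) ∷ ((λ ()) ∷ (λ ()) ∷ []) ∷ ((λ ()) ∷ []) ∷ [] ∷ [])
             ⊢∘ ⊢-pair (◇-intro ⊢∘ ⊢-fst ⊢∘ ⊢-fst)
                  (⊢-pair (◇-intro ⊢∘ ⊢-fst ⊢∘ ⊢-snd ⊢∘ ⊢-fst)
                    (⊢-pair (⊢-fst ⊢∘ ⊢-snd) (⊢-fst ⊢∘ ⊢-snd ⊢∘ ⊢-snd)))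
    □¬joint : ⊢ (Γ ⇒ □ (¬F joint))
    □¬joint = ⊢-app (⊢-app (⊢-weaken (□-lift₂ joint-excluded)) (⊢-snd ⊢∘ ⊢-snd ⊢∘ ⊢-fst))
                    (⊢-snd ⊢∘ ⊢-snd ⊢∘ ⊢-snd)

  VarOfA VarOfB : Var → Set
  VarOfA r₁ = ⊥
  VarOfA r₂ = ⊥
  VarOfA _  = ⊤
  VarOfB q₁ = ⊥
  VarOfB q₂ = ⊥
  VarOfB _  = ⊤

  shared-is-p : ∀ {x} → VarIn x antecedent → VarIn x consequent → x ≡ p
  shared-is-p inA inB = only-p (AllVars⇒VarIn {P = VarOfA} _ inA) (AllVars⇒VarIn {P = VarOfB} _ inB)
    where
    only-p : ∀ {x} → VarOfA x → VarOfB x → x ≡ p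
    only-p {p} _ _ = refl
    only-p {q₁} _ ()
    only-p {q₂} _ ()
    only-p {r₁} ()
    only-p {r₂} ()

  AgentOfA AgentOfB : Agent → Set
  AgentOfA zero       = ⊤
  AgentOfA (suc zero) = ⊤
  AgentOfA _          = ⊥
  AgentOfB (suc (suc zero))       = ⊤
  AgentOfB (suc (suc (suc zero))) = ⊤
  AgentOfB _                      = ⊥

  agents-disjoint : AgDisjoint antecedent consequent
  agents-disjoint j inA inB =
    apart (AllAgents⇒AgIn {P = AgentOfA} _ inA) (AllAgents⇒AgIn {P = AgentOfB} _ inB)
    where
    apart : ∀ {j} → AgentOfA j → AgentOfB j → ⊥
    apart {zero}                    _ ()
    apart {suc zero}                _ ()
    apart {suc (suc zero)}          ()
    apart {suc (suc (suc zero))}    ()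
    apart {suc (suc (suc (suc _)))} ()

  val₁ val₂ : Valuation Var (4 + m)
  val₁ p    = agree a₀ a₁
  val₁ q₁ u = lookup u a₀
  val₁ q₂ u = lookup u a₁
  val₁ _  _ = false
  val₂ p    = agree a₂ a₃
  val₂ r₁ u = lookup u a₂
  val₂ r₂ u = not (lookup u a₃)
  val₂ _  _ = false

  allTrue : Profile (4 + m)
  allTrue = replicate _ true

  antecedent-holds : val₁ ∣ allTrue ⊨ antecedent
  antecedent-holds k = k (λ _ e → e) λ k′ → k′ (λ _ e → e) q⇒p-valid
    where
    q⇒p-valid : val₁ ∣ allTrue ⊨ □ q⇒p
    q⇒p-valid u q₁∧q₂ =
      let (e₀ , e₁) = to (⊨-∧ {val = val₁} {w = u} {A = var q₁} {B = var q₂}) q₁∧q₂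
      in  cong₂ (λ x y → does (x ≟ y)) e₀ e₁

  opposition-holds : val₂ ∣ allTrue ⊨ opposition
  opposition-holds k = k ◇S₂ λ k′ → k′ ◇S₃ r⇒¬p-valid
    where
    ◇S₂ : val₂ ∣ allTrue ⊨ ◇ S₂
    ◇S₂ k = k allTrue λ _ e → e
    ◇S₃ : val₂ ∣ allTrue ⊨ ◇ S₃
    ◇S₃ k = k (allTrue [ a₃ ]≔ false) λ _ e → cong not e
    r⇒¬p-valid : val₂ ∣ allTrue ⊨ □ r⇒¬p
    r⇒¬p-valid u r₁∧r₂ agreeing =
      let (e₂ , e₃) = to (⊨-∧ {val = val₂} {w = u} {A = var r₁} {B = var r₂}) r₁∧r₂
          disagree = cong₂ (λ x y → does (x ≟ y)) e₂ (not-injective {y = false} e₃)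
      in  case trans (sym disagree) agreeing of λ ()

  no-interpolant : ¬ (Σ (Form Var Agent) λ C →
                      InLanguage antecedent consequent C × (⊢ (antecedent ⇒ C)) × (⊢ (C ⇒ consequent)))
  no-interpolant (C , (shared , _) , ⊢A⇒C , ⊢C⇒B) =
    sound ⊢C⇒B val₂ allTrue (to C-transfers (sound ⊢A⇒C val₁ allTrue antecedent-holds)) opposition-holds
    where
    only-p : AllVars (_≡ p) C
    only-p = VarIn⇒AllVars λ x x∈C → let (inA , inB) = shared x x∈C in shared-is-p inA inB
    C-transfers : val₁ ∣ allTrue ⊨ C ⇔ val₂ ∣ allTrue ⊨ C
    C-transfers = ⊨-transfer p val₁ val₂ (agree-neverSettled λ ()) (agree-neverSettled λ ()) C only-p refl

theorem2 : (n : ℕ) → 3 < n →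
    Σ Set λ V → Σ (Form V (Fin n)) λ A → Σ (Form V (Fin n)) λ B →
      (⊢ (A ⇒ B)) × AgDisjoint A B ×
      ¬ (Σ (Form V (Fin n)) λ C → InLanguage A B C × (⊢ (A ⇒ C)) × (⊢ (C ⇒ B)))
theorem2 (suc (suc (suc (suc m)))) (s≤s (s≤s (s≤s (s≤s _)))) =
  Var , antecedent , consequent , antecedent⇒consequent , agents-disjoint , no-interpolant
  where open Counterexample m
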